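{- For $n\ge1$, $$B_{2n}^+(x,y)=(1-x)^n(1-y)^{n-1}Q^+_{2n}\!\left(\frac{x}{1-x},\frac{y}{1-y}\right),\qquad B_{2n-1}^+(x,y)=(1-x)^{n-1}(1-y)^{n-1}Q^+_{2n-1}\!\left(\frac{x}{1-x},\frac{y}{1-y}\right).$$
   Context: $\mathcal{B}_m$ is the set of signed permutations of $\{\pm1,\dots,\pm m\}$ ($\sigma(-i)=-\sigma(i)$), identified with words $\sigma(0)\sigma(1)\cdots\sigma(m)$, $\sigma(0)=0$; $\mathcal{B}^+_m$ is the subset with $\sigma(1)>0$. A position $i\in\{0,\dots,m-1\}$ is a descent if $\sigma(i)>\sigma(i+1)$; $\mathrm{des}_1\sigma,\mathrm{des}_0\sigma$ count descents at odd, resp. even, positions. $B^+_m(x,y)=\sum_{\sigma\in\mathcal{B}^+_m}x^{\mathrm{des}_1\sigma}y^{\mathrm{des}_0\sigma}$. For $S\subseteq[m-1]$, $\alpha^+_m(S)$ is the number of $\sigma\in\mathcal{B}^+_m$ whose descent set is contained in $S$; $S_o,S_e$ are the odd, resp. even, elements of $S$; and $Q^+_m(x,y)=\sum_{S\subseteq[m-1]}\alpha^+_m(S)x^{|S_o|}y^{|S_e|}$. -}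

module Defs where

open import Data.Bool using (Bool; true; false; if_then_else_; _∧_; not)
open import Data.Nat as ℕ using (ℕ; zero; suc)
open import Data.Integer as ℤ using (ℤ; +_; -[1+_]; ∣_∣)
open import Data.List using (List; []; _∷_; map; filter; length; upTo; concatMap; foldr; _++_)
open import Data.Rational as ℚ using (ℚ; 0ℚ; 1ℚ)
open import Relation.Nullary.Decidable using (⌊_⌋; does)
open import Relation.Unary using (Decidable)
open import Relation.Binary.PropositionalEquality using (_≡_)

range : ℕ → List ℕ
range k = map suc (upTo k)

letters : ℕ → List ℤ
letters m = map (λ i → + i) (range m) ++ map (λ i → ℤ.- (+ i)) (range m)

words : {A : Set} → List A → ℕ → List (List A)
words as zero    = [] ∷ []
words as (suc k) = concatMap (λ a → map (a ∷_) (words as k)) as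

memℕ : ℕ → List ℕ → Bool
memℕ a []      = false
memℕ a (b ∷ l) = if ⌊ a ℕ.≟ b ⌋ then true else memℕ a l

distinctℕ : List ℕ → Bool
distinctℕ []      = true
distinctℕ (a ∷ l) = not (memℕ a l) ∧ distinctℕ l

-- signed permutations of [m], as words σ(1)…σ(m) with letters in ±[m]
-- and pairwise distinct absolute values (σ(-i) = -σ(i) is then implicit)
signedPerms : ℕ → List (List ℤ)
signedPerms m = filter (λ w → distinctℕ (map ∣_∣ w) ≡? true) (words (letters m) m)
  where
  _≡?_ : (a b : Bool) → Relation.Nullary.Decidable.Dec (a ≡ b)
  _≡?_ = Data.Bool._≟_
    where import Data.Bool

posFirst : List ℤ → Bool
posFirst []      = false
posFirst (a ∷ _) = ⌊ + 0 ℤ.<? a ⌋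

signedPermsPlus : ℕ → List (List ℤ)
signedPermsPlus m = filter (λ w → posFirst w Data.Bool.≟ true) (signedPerms m)
  where import Data.Bool

descPosFrom : ℕ → List ℤ → List ℕ
descPosFrom i []            = []
descPosFrom i (a ∷ [])      = []
descPosFrom i (a ∷ b ∷ r) =
  if ⌊ b ℤ.<? a ⌋ then i ∷ descPosFrom (suc i) (b ∷ r) else descPosFrom (suc i) (b ∷ r)

-- descent set of σ, with σ(0) = 0 prepended; positions in {0,…,m-1}
descSet : List ℤ → List ℕ
descSet w = descPosFrom 0 (+ 0 ∷ w)

isEven : ℕ → Bool
isEven zero          = true
isEven (suc zero)    = false
isEven (suc (suc n)) = isEven n

countOdd : List ℕ → ℕ
countOdd l = length (filter (λ i → isEven i Data.Bool.≟ false) l)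
  where import Data.Bool

countEven : List ℕ → ℕ
countEven l = length (filter (λ i → isEven i Data.Bool.≟ true) l)
  where import Data.Bool

des₁ : List ℤ → ℕ
des₁ w = countOdd (descSet w)

des₀ : List ℤ → ℕ
des₀ w = countEven (descSet w)

pow : ℚ → ℕ → ℚ
pow q zero    = 1ℚ
pow q (suc k) = q ℚ.* pow q k

sumℚ : List ℚ → ℚ
sumℚ = foldr ℚ._+_ 0ℚ

natℚ : ℕ → ℚ
natℚ k = (+ k) ℚ./ 1

Bplus : ℕ → ℚ → ℚ → ℚ
Bplus m x y = sumℚ (map (λ σ → pow x (des₁ σ) ℚ.* pow y (des₀ σ)) (signedPermsPlus m))

subsets : List ℕ → List (List ℕ)
subsets []      = [] ∷ []
subsets (a ∷ l) = subsets l ++ map (a ∷_) (subsets l)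

subsetᵇ : List ℕ → List ℕ → Bool
subsetᵇ []      s = true
subsetᵇ (a ∷ l) s = memℕ a s ∧ subsetᵇ l s

alphaPlus : ℕ → List ℕ → ℕ
alphaPlus m S = length (filter (λ σ → subsetᵇ (descSet σ) S Data.Bool.≟ true) (signedPermsPlus m))
  where import Data.Bool

Qplus : ℕ → ℚ → ℚ → ℚ
Qplus m x y = sumℚ (map (λ S → natℚ (alphaPlus m S) ℚ.* pow x (countOdd S) ℚ.* pow y (countEven S))
                        (subsets (range (m ℕ.∸ 1))))

-- Put X = x/(1-x), Y = y/(1-y) and weight a position e by X or Y according to its parity.
-- Expanding α⁺_m(S) as a sum over σ, each σ contributes the total weight of the sets S with
-- Des σ ⊆ S ⊆ [m-1], which factors as ∏_{e ∈ Des σ} w(e) · ∏_{e ∉ Des σ} (1 + w(e)).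
-- Since (1-x)X = x and (1-x)(1+X) = 1, multiplying by the product of 1-x (odd e) and 1-y
-- (even e) over [m-1] turns this into x^{des₁ σ} y^{des₀ σ}; for σ ∈ B⁺_m position 0 is never
-- a descent, so Des σ ⊆ [m-1]. Finally [2n-1] has n odd and n-1 even elements, [2n-2] n-1 of each.

module Submission where

open import Algebra.Bundles using (CommutativeMonoid)
import Algebra.Properties.CommutativeSemigroup as CommSemigroupProperties
open import Data.Empty using (⊥-elim)
open import Data.Bool using (Bool; true; false; if_then_else_; _∧_; not)
import Data.Bool as B
import Data.Bool.Properties as BP
open import Data.Integer as ℤ using (ℤ; +_)
import Data.Integer.Properties as ℤP
open import Data.List using (List; []; _∷_; map; filter; length; _++_; upTo)
import Data.List.Properties as LP
open import Data.List.Relation.Unary.All as All using (All; []; _∷_)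
import Data.List.Relation.Unary.All.Properties as AllP
open import Data.Nat as ℕ using (ℕ; zero; suc; _+_; _∸_; _*_; _≤_; s≤s; z≤n)
import Data.Nat.Properties as ℕP
open import Data.Product using (_×_; _,_)
open import Data.Rational as Q using (ℚ; 0ℚ; 1ℚ; _-_; _÷_; ≢-nonZero)
import Data.Rational.Properties as QP
import Data.Rational.Unnormalised as Qᵘ
import Data.Rational.Unnormalised.Properties as QᵘP
open import Data.Rational.Solver using (module +-*-Solver)
open import Function using (_∘_)
open import Relation.Binary.PropositionalEquality
open import Relation.Nullary using (yes; no; contradiction)
open import Relation.Nullary.Decidable using (⌊_⌋)

open import Defs

open ≡-Reasoning
open +-*-Solver using (solve; con; _:+_; _:-_; _:*_; _:=_)
open CommSemigroupProperties (CommutativeMonoid.commutativeSemigroup QP.+-0-commutativeMonoid)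
  using (interchange)
open CommSemigroupProperties (CommutativeMonoid.commutativeSemigroup QP.*-1-commutativeMonoid)
  renaming (x∙yz≈y∙xz to *-exchange) using ()
open CommSemigroupProperties (CommutativeMonoid.commutativeSemigroup BP.∧-commutativeMonoid)
  renaming (x∙yz≈y∙xz to ∧-exchange) using ()

sum-++ : ∀ {A : Set} (f : A → ℚ) xs ys →
         sumℚ (map f (xs ++ ys)) ≡ sumℚ (map f xs) Q.+ sumℚ (map f ys)
sum-++ f []       ys = sym (QP.+-identityˡ _)
sum-++ f (x ∷ xs) ys = trans (cong (f x Q.+_) (sum-++ f xs ys)) (sym (QP.+-assoc (f x) _ _))

sum-cong : ∀ {A : Set} {f g : A → ℚ} {xs} →
           All (λ z → f z ≡ g z) xs → sumℚ (map f xs) ≡ sumℚ (map g xs)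
sum-cong []       = refl
sum-cong (p ∷ ps) = cong₂ Q._+_ p (sum-cong ps)

sum-+ : ∀ {A : Set} (f g : A → ℚ) xs →
        sumℚ (map (λ z → f z Q.+ g z) xs) ≡ sumℚ (map f xs) Q.+ sumℚ (map g xs)
sum-+ f g []       = refl
sum-+ f g (x ∷ xs) = trans (cong (f x Q.+ g x Q.+_) (sum-+ f g xs)) (interchange (f x) (g x) _ _)

*-sum : ∀ {A : Set} c (f : A → ℚ) xs → c Q.* sumℚ (map f xs) ≡ sumℚ (map (λ z → c Q.* f z) xs)
*-sum c f []       = QP.*-zeroʳ c
*-sum c f (x ∷ xs) = trans (QP.*-distribˡ-+ c (f x) _) (cong (c Q.* f x Q.+_) (*-sum c f xs))

sum-zero : ∀ {A : Set} (xs : List A) → sumℚ (map (λ _ → 0ℚ) xs) ≡ 0ℚ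
sum-zero []       = refl
sum-zero (x ∷ xs) = cong (0ℚ Q.+_) (sum-zero xs)

∏ : (ℕ → ℚ) → List ℕ → ℚ
∏ f []      = 1ℚ
∏ f (e ∷ D) = f e Q.* ∏ f D

memℕ-≢ : ∀ {e a} S → e ≢ a → memℕ e (a ∷ S) ≡ memℕ e S
memℕ-≢ {e} {a} S e≢a with e ℕ.≟ a
... | yes e≡a = ⊥-elim (e≢a e≡a)
... | no _    = refl

remove : ℕ → List ℕ → List ℕ
remove e []      = []
remove e (d ∷ D) = if ⌊ e ℕ.≟ d ⌋ then remove e D else d ∷ remove e D

data Distinct : List ℕ → Set where
  []  : Distinct []
  _∷_ : ∀ {a l} → memℕ a l ≡ false → Distinct l → Distinct (a ∷ l)

_⊆_ : List ℕ → List ℕ → Set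
D ⊆ L = All (λ d → memℕ d L ≡ true) D

memℕ-∷-self : ∀ e S → memℕ e (e ∷ S) ≡ true
memℕ-∷-self e S with e ℕ.≟ e
... | yes _   = refl
... | no e≢e = ⊥-elim (e≢e refl)

remove-∉ : ∀ {e} D → memℕ e D ≡ false → remove e D ≡ D
remove-∉ []      _  = refl
remove-∉ {e} (d ∷ D) e∉ with e ℕ.≟ d
... | yes refl = contradiction e∉ λ ()
... | no _     = cong (d ∷_) (remove-∉ D e∉)

memℕ-remove : ∀ {a e} l → memℕ a l ≡ false → memℕ a (remove e l) ≡ false
memℕ-remove []      _ = refl
memℕ-remove {a} {e} (d ∷ l) a∉ with a ℕ.≟ d | e ℕ.≟ d
... | yes refl | _     = contradiction a∉ λ ()
... | no _     | yes _ = memℕ-remove {a} {e} l a∉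
... | no a≢d   | no _  = trans (memℕ-≢ (remove e l) a≢d) (memℕ-remove l a∉)

Distinct-remove : ∀ {e D} → Distinct D → Distinct (remove e D)
Distinct-remove [] = []
Distinct-remove {e} {d ∷ D} (d∉D ∷ distinct) with e ℕ.≟ d
... | yes _ = Distinct-remove distinct
... | no _  = memℕ-remove D d∉D ∷ Distinct-remove distinct

⊆-remove : ∀ {e l} D → D ⊆ (e ∷ l) → remove e D ⊆ l
⊆-remove []      []        = []
⊆-remove {e} {l} (d ∷ D) (d∈ ∷ D⊆) with e ℕ.≟ d
... | yes _  = ⊆-remove {e} {l} D D⊆
... | no e≢d = trans (sym (memℕ-≢ l (e≢d ∘ sym))) d∈ ∷ ⊆-remove {e} {l} D D⊆

∏-remove : ∀ (f : ℕ → ℚ) {e D} → Distinct D → memℕ e D ≡ true → ∏ f D ≡ f e Q.* ∏ f (remove e D)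
∏-remove f {e} {d ∷ D} (d∉D ∷ distinct) e∈ with e ℕ.≟ d
... | yes refl = cong (λ D′ → f e Q.* ∏ f D′) (sym (remove-∉ D d∉D))
... | no _     = trans (cong (f d Q.*_) (∏-remove f distinct e∈)) (*-exchange (f d) (f e) _)

subsetᵇ-cons : ∀ D e S → subsetᵇ D (e ∷ S) ≡ subsetᵇ (remove e D) S
subsetᵇ-cons []      e S = refl
subsetᵇ-cons (d ∷ D) e S with e ℕ.≟ d
... | yes refl rewrite memℕ-∷-self e S = subsetᵇ-cons D e S
... | no e≢d   rewrite memℕ-≢ S (e≢d ∘ sym) = cong (memℕ d S ∧_) (subsetᵇ-cons D e S)

subsetᵇ-∉ : ∀ D {e S} → memℕ e S ≡ false → subsetᵇ D S ≡ not (memℕ e D) ∧ subsetᵇ (remove e D) S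
subsetᵇ-∉ []      _   = refl
subsetᵇ-∉ (d ∷ D) {e} {S} e∉S with e ℕ.≟ d
... | yes refl rewrite e∉S = refl
... | no _ = trans (cong (memℕ d S ∧_) (subsetᵇ-∉ D e∉S)) (∧-exchange (memℕ d S) (not (memℕ e D)) _)

subsets-∉ : ∀ {e} l → memℕ e l ≡ false → All (λ S → memℕ e S ≡ false) (subsets l)
subsets-∉ []      _  = refl ∷ []
subsets-∉ {e} (a ∷ l) e∉ with e ℕ.≟ a
... | yes refl = contradiction e∉ λ ()
... | no e≢a   =
  AllP.++⁺ (subsets-∉ l e∉) (AllP.map⁺ (All.map (λ {S} → trans (memℕ-≢ S e≢a)) (subsets-∉ l e∉)))

upperSum : (ℕ → ℚ) → List ℕ → List ℕ → ℚ
upperSum w L D = sumℚ (map (λ S → if subsetᵇ D S then ∏ w S else 0ℚ) (subsets L))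

upperSum-cons : ∀ (w : ℕ → ℚ) {e} l D → memℕ e l ≡ false →
                upperSum w (e ∷ l) D
                ≡ (if memℕ e D then 0ℚ else upperSum w l (remove e D)) Q.+ w e Q.* upperSum w l (remove e D)
upperSum-cons w {e} l D e∉l = begin
  upperSum w (e ∷ l) D
    ≡⟨ sum-++ term (subsets l) (map (e ∷_) (subsets l)) ⟩
  sumℚ (map term (subsets l)) Q.+ sumℚ (map term (map (e ∷_) (subsets l)))
    ≡⟨ cong₂ Q._+_ without-e with-e ⟩
  (if memℕ e D then 0ℚ else upperSum w l (remove e D)) Q.+ w e Q.* upperSum w l (remove e D) ∎
  where
  term : List ℕ → ℚ
  term S = if subsetᵇ D S then ∏ w S else 0ℚ

  without-e : sumℚ (map term (subsets l)) ≡ (if memℕ e D then 0ℚ else upperSum w l (remove e D))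
  without-e = trans (sum-cong (All.map (λ {S} e∉S → cong (λ b → if b then ∏ w S else 0ℚ) (subsetᵇ-∉ D e∉S))
                                       (subsets-∉ l e∉l)))
                    (case-memℕ (memℕ e D))
    where
    case-memℕ : ∀ b → sumℚ (map (λ S → if not b ∧ subsetᵇ (remove e D) S then ∏ w S else 0ℚ) (subsets l))
                      ≡ (if b then 0ℚ else upperSum w l (remove e D))
    case-memℕ true  = sum-zero (subsets l)
    case-memℕ false = refl

  with-e : sumℚ (map term (map (e ∷_) (subsets l))) ≡ w e Q.* upperSum w l (remove e D)
  with-e = begin
    sumℚ (map term (map (e ∷_) (subsets l)))
      ≡⟨ cong sumℚ (LP.map-∘ (subsets l)) ⟨
    sumℚ (map (term ∘ (e ∷_)) (subsets l))
      ≡⟨ sum-cong (All.universal split (subsets l)) ⟩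
    sumℚ (map (λ S → w e Q.* (if subsetᵇ (remove e D) S then ∏ w S else 0ℚ)) (subsets l))
      ≡⟨ *-sum (w e) _ (subsets l) ⟨
    w e Q.* upperSum w l (remove e D) ∎
    where
    split : ∀ S → term (e ∷ S) ≡ w e Q.* (if subsetᵇ (remove e D) S then ∏ w S else 0ℚ)
    split S rewrite subsetᵇ-cons D e S with subsetᵇ (remove e D) S
    ... | true  = refl
    ... | false = sym (QP.*-zeroʳ (w e))

∏-upperSum : ∀ (c w u : ℕ → ℚ) → (∀ e → c e Q.* w e ≡ u e) → (∀ e → c e Q.* (1ℚ Q.+ w e) ≡ 1ℚ) →
             ∀ {L D} → Distinct L → Distinct D → D ⊆ L → ∏ c L Q.* upperSum w L D ≡ ∏ u D
∏-upperSum c w u cw≡u c[1+w]≡1 {[]}    {[]}    _ _ _ = refl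
∏-upperSum c w u cw≡u c[1+w]≡1 {[]}    {d ∷ D} _ _ (() ∷ _)
∏-upperSum c w u cw≡u c[1+w]≡1 {e ∷ l} {D} (e∉l ∷ distinctL) distinctD D⊆ = begin
  ∏ c (e ∷ l) Q.* upperSum w (e ∷ l) D
    ≡⟨ cong (∏ c (e ∷ l) Q.*_) (upperSum-cons w l D e∉l) ⟩
  c e Q.* ∏ c l Q.* ((if memℕ e D then 0ℚ else G) Q.+ w e Q.* G)
    ≡⟨ case-memℕ (memℕ e D) refl ⟩
  ∏ u D ∎
  where
  G : ℚ
  G = upperSum w l (remove e D)
  ih : ∏ c l Q.* G ≡ ∏ u (remove e D)
  ih = ∏-upperSum c w u cw≡u c[1+w]≡1 distinctL (Distinct-remove distinctD) (⊆-remove {e} {l} D D⊆)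
  case-memℕ : ∀ b → memℕ e D ≡ b → c e Q.* ∏ c l Q.* ((if b then 0ℚ else G) Q.+ w e Q.* G) ≡ ∏ u D
  case-memℕ true e∈D = begin
    c e Q.* ∏ c l Q.* (0ℚ Q.+ w e Q.* G)
      ≡⟨ solve 4 (λ c P w G → c :* P :* (con 0ℚ :+ w :* G) := (c :* w) :* (P :* G)) refl (c e) (∏ c l) (w e) G ⟩
    (c e Q.* w e) Q.* (∏ c l Q.* G)
      ≡⟨ cong₂ Q._*_ (cw≡u e) ih ⟩
    u e Q.* ∏ u (remove e D)
      ≡⟨ ∏-remove u distinctD e∈D ⟨
    ∏ u D ∎
  case-memℕ false e∉D = begin
    c e Q.* ∏ c l Q.* (G Q.+ w e Q.* G)
      ≡⟨ solve 4 (λ c P w G → c :* P :* (G :+ w :* G) := (c :* (con 1ℚ :+ w)) :* (P :* G)) refl (c e) (∏ c l) (w e) G ⟩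
    (c e Q.* (1ℚ Q.+ w e)) Q.* (∏ c l Q.* G)
      ≡⟨ cong₂ Q._*_ (c[1+w]≡1 e) ih ⟩
    1ℚ Q.* ∏ u (remove e D)
      ≡⟨ QP.*-identityˡ _ ⟩
    ∏ u (remove e D)
      ≡⟨ cong (∏ u) (remove-∉ D e∉D) ⟩
    ∏ u D ∎

countOdd-cons : ∀ d D → countOdd (d ∷ D) ≡ (if isEven d then 0 else 1) + countOdd D
countOdd-cons d D with isEven d
... | true  = refl
... | false = refl

countEven-cons : ∀ d D → countEven (d ∷ D) ≡ (if isEven d then 1 else 0) + countEven D
countEven-cons d D with isEven d
... | true  = refl
... | false = refl

parity : ℚ → ℚ → ℕ → ℚ
parity p q e = if isEven e then q else p

∏-parity : ∀ p q S → ∏ (parity p q) S ≡ pow p (countOdd S) Q.* pow q (countEven S)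
∏-parity p q []      = refl
∏-parity p q (e ∷ S) rewrite countOdd-cons e S | countEven-cons e S with isEven e
... | true  = trans (cong (q Q.*_) (∏-parity p q S)) (*-exchange q (pow p (countOdd S)) _)
... | false = trans (cong (p Q.*_) (∏-parity p q S)) (sym (QP.*-assoc p _ _))

-- natℚ k is definitionally fromℚᵘ (mkℚᵘ (+ k) 0).
natℚ-suc : ∀ k → natℚ (suc k) ≡ 1ℚ Q.+ natℚ k
natℚ-suc k = QP.toℚᵘ-injective
  (≃-trans (QP.toℚᵘ-fromℚᵘ (Qᵘ.mkℚᵘ (+ suc k) 0))
  (≃-trans (Qᵘ.*≡* eq)
  (≃-sym (≃-trans (QP.toℚᵘ-homo-+ 1ℚ (natℚ k)) (QᵘP.+-congʳ (Q.toℚᵘ 1ℚ) (QP.toℚᵘ-fromℚᵘ (Qᵘ.mkℚᵘ (+ k) 0)))))))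
  where
  open QᵘP using (≃-trans; ≃-sym)
  eq : + suc k ℤ.* + 1 ≡ (+ 1 ℤ.* + 1 ℤ.+ + k ℤ.* + 1) ℤ.* + 1
  eq = trans (ℤP.*-identityʳ (+ suc k)) (sym (trans (ℤP.*-identityʳ _) (cong (ℤ._+_ (+ 1)) (ℤP.*-identityʳ (+ k)))))

sum-count-swap : ∀ {A B : Set} (t : A → B → Bool) (f : B → ℚ) σs Ss →
  sumℚ (map (λ S → natℚ (length (filter (λ σ → t σ S B.≟ true) σs)) Q.* f S) Ss)
  ≡ sumℚ (map (λ σ → sumℚ (map (λ S → if t σ S then f S else 0ℚ) Ss)) σs)
sum-count-swap t f []       Ss = trans (sum-cong (All.universal (λ S → QP.*-zeroˡ (f S)) Ss)) (sum-zero Ss)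
sum-count-swap {A} {B} t f (σ ∷ σs) Ss = begin
  sumℚ (map (λ S → natℚ (count (σ ∷ σs) S) Q.* f S) Ss)
    ≡⟨ sum-cong (All.universal split Ss) ⟩
  sumℚ (map (λ S → (if t σ S then f S else 0ℚ) Q.+ natℚ (count σs S) Q.* f S) Ss)
    ≡⟨ sum-+ _ _ Ss ⟩
  sumℚ (map (λ S → if t σ S then f S else 0ℚ) Ss) Q.+ sumℚ (map (λ S → natℚ (count σs S) Q.* f S) Ss)
    ≡⟨ cong (sumℚ (map (λ S → if t σ S then f S else 0ℚ) Ss) Q.+_) (sum-count-swap t f σs Ss) ⟩
  sumℚ (map (λ σ → sumℚ (map (λ S → if t σ S then f S else 0ℚ) Ss)) (σ ∷ σs)) ∎
  where
  count : List A → B → ℕ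
  count σs S = length (filter (λ σ → t σ S B.≟ true) σs)
  split : ∀ S → natℚ (count (σ ∷ σs) S) Q.* f S ≡ (if t σ S then f S else 0ℚ) Q.+ natℚ (count σs S) Q.* f S
  split S with t σ S
  ... | true  = begin
    natℚ (suc (count σs S)) Q.* f S       ≡⟨ cong (Q._* f S) (natℚ-suc (count σs S)) ⟩
    (1ℚ Q.+ natℚ (count σs S)) Q.* f S    ≡⟨ QP.*-distribʳ-+ (f S) 1ℚ (natℚ (count σs S)) ⟩
    1ℚ Q.* f S Q.+ natℚ (count σs S) Q.* f S ≡⟨ cong (Q._+ natℚ (count σs S) Q.* f S) (QP.*-identityˡ (f S)) ⟩
    f S Q.+ natℚ (count σs S) Q.* f S ∎
  ... | false = sym (QP.+-identityˡ (natℚ (count σs S) Q.* f S))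

range-suc : ∀ k → range (suc k) ≡ 1 ∷ map suc (range k)
range-suc k = cong (λ l → 1 ∷ map suc l) (sym (LP.map-applyUpTo (λ i → i) suc k))

memℕ-map-suc : ∀ d L → memℕ (suc d) (map suc L) ≡ memℕ d L
memℕ-map-suc d []      = refl
memℕ-map-suc d (a ∷ L) with d ℕ.≟ a
... | yes refl = memℕ-∷-self (suc d) (map suc L)
... | no d≢a   = trans (memℕ-≢ (map suc L) (d≢a ∘ ℕP.suc-injective)) (memℕ-map-suc d L)

memℕ-zero-map-suc : ∀ L → memℕ 0 (map suc L) ≡ false
memℕ-zero-map-suc []      = refl
memℕ-zero-map-suc (a ∷ L) = memℕ-zero-map-suc L

Distinct-map-suc : ∀ {L} → Distinct L → Distinct (map suc L)
Distinct-map-suc []                 = []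
Distinct-map-suc {a ∷ l} (a∉l ∷ d) = trans (memℕ-map-suc a l) a∉l ∷ Distinct-map-suc d

Distinct-range : ∀ k → Distinct (range k)
Distinct-range zero    = []
Distinct-range (suc k) rewrite range-suc k =
  trans (memℕ-map-suc 0 (range k)) (memℕ-zero-map-suc (upTo k)) ∷ Distinct-map-suc (Distinct-range k)

memℕ-range : ∀ k d → 1 ≤ d → d ≤ k → memℕ d (range k) ≡ true
memℕ-range (suc k) (suc zero)    _ _         = cong (memℕ 1) (range-suc k)
memℕ-range (suc k) (suc (suc d)) _ (s≤s d<k) = begin
  memℕ (suc (suc d)) (range (suc k))          ≡⟨ cong (memℕ (suc (suc d))) (range-suc k) ⟩
  memℕ (suc (suc d)) (1 ∷ map suc (range k))  ≡⟨ memℕ-≢ {a = 1} (map suc (range k)) (λ ()) ⟩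
  memℕ (suc (suc d)) (map suc (range k))      ≡⟨ memℕ-map-suc (suc d) (range k) ⟩
  memℕ (suc d) (range k)                      ≡⟨ memℕ-range k (suc d) (s≤s z≤n) d<k ⟩
  true                                        ∎

isEven-suc : ∀ d → isEven (suc d) ≡ not (isEven d)
isEven-suc zero          = refl
isEven-suc (suc zero)    = refl
isEven-suc (suc (suc d)) = isEven-suc d

countOdd-map-suc  : ∀ L → countOdd (map suc L) ≡ countEven L
countEven-map-suc : ∀ L → countEven (map suc L) ≡ countOdd L
countOdd-map-suc [] = refl
countOdd-map-suc (d ∷ L) rewrite isEven-suc d with isEven d
... | true  = cong suc (countOdd-map-suc L)
... | false = countOdd-map-suc L
countEven-map-suc [] = refl
countEven-map-suc (d ∷ L) rewrite isEven-suc d with isEven d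
... | true  = countEven-map-suc L
... | false = cong suc (countEven-map-suc L)

countOdd-range-suc : ∀ k → countOdd (range (suc k)) ≡ suc (countEven (range k))
countOdd-range-suc k = trans (cong countOdd (range-suc k)) (cong suc (countOdd-map-suc (range k)))

countEven-range-suc : ∀ k → countEven (range (suc k)) ≡ countOdd (range k)
countEven-range-suc k = trans (cong countEven (range-suc k)) (countEven-map-suc (range k))

range-counts-odd  : ∀ k → countOdd (range (suc (k + k))) ≡ suc k × countEven (range (suc (k + k))) ≡ k
range-counts-even : ∀ k → countOdd (range (k + k)) ≡ k × countEven (range (k + k)) ≡ k
range-counts-odd k with odd≡k , even≡k ← range-counts-even k =
  trans (countOdd-range-suc (k + k)) (cong suc even≡k) , trans (countEven-range-suc (k + k)) odd≡k
range-counts-even zero = refl , refl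
range-counts-even (suc k) rewrite ℕP.+-suc k k with odd≡suck , even≡k ← range-counts-odd k =
  trans (countOdd-range-suc (suc (k + k))) (cong suc even≡k) ,
  trans (countEven-range-suc (suc (k + k))) odd≡suck

descSet-posFirst : ∀ s r → posFirst (s ∷ r) ≡ true → descSet (s ∷ r) ≡ descPosFrom 1 (s ∷ r)
descSet-posFirst s r s>0 with + 0 ℤ.<? s | s ℤ.<? + 0
... | yes 0<s | yes s<0 = ⊥-elim (ℤP.<-asym 0<s s<0)
... | yes _   | no _    = refl
... | no _    | _       = contradiction s>0 λ ()

descPosFrom-bounds : ∀ i w → All (λ d → i ≤ d × d + 2 ≤ i + length w) (descPosFrom i w)
descPosFrom-bounds i []          = []
descPosFrom-bounds i (a ∷ [])    = []
descPosFrom-bounds i (a ∷ b ∷ r) =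
  with-descent ⌊ b ℤ.<? a ⌋ (All.map widen (descPosFrom-bounds (suc i) (b ∷ r)))
  where
  Bounded : ℕ → Set
  Bounded d = i ≤ d × d + 2 ≤ i + length (a ∷ b ∷ r)
  widen : ∀ {d} → suc i ≤ d × d + 2 ≤ suc i + length (b ∷ r) → Bounded d
  widen (i<d , bound) = ℕP.<⇒≤ i<d , ℕP.≤-trans bound (ℕP.≤-reflexive (sym (ℕP.+-suc i _)))
  with-descent : ∀ c → All Bounded (descPosFrom (suc i) (b ∷ r)) →
                 All Bounded (if c then i ∷ descPosFrom (suc i) (b ∷ r) else descPosFrom (suc i) (b ∷ r))
  with-descent true  rest = (ℕP.≤-refl , ℕP.+-monoʳ-≤ i (s≤s (s≤s z≤n))) ∷ rest
  with-descent false rest = rest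

memℕ-<-all : ∀ {i} l → All (suc i ≤_) l → memℕ i l ≡ false
memℕ-<-all []      []           = refl
memℕ-<-all (d ∷ l) (i<d ∷ i<l) = trans (memℕ-≢ l (ℕP.<⇒≢ i<d)) (memℕ-<-all l i<l)

Distinct-descPosFrom : ∀ i w → Distinct (descPosFrom i w)
Distinct-descPosFrom i []          = []
Distinct-descPosFrom i (a ∷ [])    = []
Distinct-descPosFrom i (a ∷ b ∷ r) = with-descent ⌊ b ℤ.<? a ⌋ (Distinct-descPosFrom (suc i) (b ∷ r))
  where
  with-descent : ∀ c → Distinct (descPosFrom (suc i) (b ∷ r)) →
                 Distinct (if c then i ∷ descPosFrom (suc i) (b ∷ r) else descPosFrom (suc i) (b ∷ r))
  with-descent true  rest =
    memℕ-<-all _ (All.map (λ (i<d , _) → i<d) (descPosFrom-bounds (suc i) (b ∷ r))) ∷ rest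
  with-descent false rest = rest

length-words : ∀ {A : Set} (as : List A) k → All (λ w → length w ≡ k) (words as k)
length-words as zero    = refl ∷ []
length-words as (suc k) =
  AllP.concat⁺ (AllP.map⁺ (All.universal (λ a → AllP.map⁺ (All.map (cong suc) (length-words as k))) as))

signedPermsPlus-shape : ∀ m → All (λ σ → posFirst σ ≡ true × length σ ≡ m) (signedPermsPlus m)
signedPermsPlus-shape m =
  All.zip ( AllP.all-filter (λ w → posFirst w B.≟ true) (signedPerms m)
          , AllP.filter⁺ (λ w → posFirst w B.≟ true) (AllP.filter⁺ _ (length-words (letters m) m)))

descSet-signedPermsPlus : ∀ m → All (λ σ → Distinct (descSet σ) × descSet σ ⊆ range (m ∸ 1)) (signedPermsPlus m)
descSet-signedPermsPlus m = All.map (λ {σ} → shape⇒descSet {σ}) (signedPermsPlus-shape m)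
  where
  shape⇒descSet : ∀ {σ} → posFirst σ ≡ true × length σ ≡ m → Distinct (descSet σ) × descSet σ ⊆ range (m ∸ 1)
  shape⇒descSet {s ∷ r} (s>0 , refl) rewrite descSet-posFirst s r s>0 =
    Distinct-descPosFrom 1 (s ∷ r) , All.map in-range (descPosFrom-bounds 1 (s ∷ r))
    where
    in-range : ∀ {d} → 1 ≤ d × d + 2 ≤ 1 + length (s ∷ r) → memℕ d (range (length (s ∷ r) ∸ 1)) ≡ true
    in-range {d} (1≤d , bound) =
      memℕ-range _ d 1≤d (ℕP.m+n≤o⇒m≤o∸n d {1} (ℕ.s≤s⁻¹ (ℕP.≤-trans (ℕP.≤-reflexive (sym (ℕP.+-suc d 1))) bound)))

module _ (x : ℚ) (hx : 1ℚ - x ≢ 0ℚ) where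

  private
    instance
      1-x≢0 : Q.NonZero (1ℚ - x)
      1-x≢0 = ≢-nonZero hx

  [1-x]*[x÷[1-x]]≡x : (1ℚ - x) Q.* (x ÷ (1ℚ - x)) ≡ x
  [1-x]*[x÷[1-x]]≡x = begin
    (1ℚ - x) Q.* (x Q.* Q.1/ (1ℚ - x))   ≡⟨ *-exchange (1ℚ - x) x _ ⟩
    x Q.* ((1ℚ - x) Q.* Q.1/ (1ℚ - x))   ≡⟨ cong (x Q.*_) (QP.*-inverseʳ (1ℚ - x)) ⟩
    x Q.* 1ℚ                              ≡⟨ QP.*-identityʳ x ⟩
    x                                     ∎

  [1-x]*[1+x÷[1-x]]≡1 : (1ℚ - x) Q.* (1ℚ Q.+ x ÷ (1ℚ - x)) ≡ 1ℚ
  [1-x]*[1+x÷[1-x]]≡1 = begin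
    (1ℚ - x) Q.* (1ℚ Q.+ x ÷ (1ℚ - x))          ≡⟨ QP.*-distribˡ-+ (1ℚ - x) 1ℚ _ ⟩
    (1ℚ - x) Q.* 1ℚ Q.+ (1ℚ - x) Q.* (x ÷ (1ℚ - x)) ≡⟨ cong₂ Q._+_ (QP.*-identityʳ (1ℚ - x)) [1-x]*[x÷[1-x]]≡x ⟩
    (1ℚ - x) Q.+ x                                ≡⟨ solve 1 (λ x → (con 1ℚ :- x) :+ x := con 1ℚ) refl x ⟩
    1ℚ                                            ∎

Bplus≡Qplus : ∀ m x y (hx : 1ℚ - x ≢ 0ℚ) (hy : 1ℚ - y ≢ 0ℚ) →
  Bplus m x y ≡ pow (1ℚ - x) (countOdd (range (m ∸ 1))) Q.* pow (1ℚ - y) (countEven (range (m ∸ 1)))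
                  Q.* Qplus m ((x ÷ (1ℚ - x)) {{≢-nonZero hx}}) ((y ÷ (1ℚ - y)) {{≢-nonZero hy}})
Bplus≡Qplus m x y hx hy = begin
  Bplus m x y
    ≡⟨ sum-cong (All.map (λ {σ} (distinct , D⊆L) → via-upperSum {σ} distinct D⊆L) (descSet-signedPermsPlus m)) ⟩
  sumℚ (map (λ σ → ∏ C L Q.* upperSum W L (descSet σ)) σs)
    ≡⟨ *-sum (∏ C L) (upperSum W L ∘ descSet) σs ⟨
  ∏ C L Q.* sumℚ (map (upperSum W L ∘ descSet) σs)
    ≡⟨ cong₂ Q._*_ (∏-parity a b L) (sym (sum-count-swap (λ σ S → subsetᵇ (descSet σ) S) (∏ W) σs (subsets L))) ⟩
  pow a (countOdd L) Q.* pow b (countEven L) Q.* sumℚ (map (λ S → natℚ (alphaPlus m S) Q.* ∏ W S) (subsets L))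
    ≡⟨ cong (pow a (countOdd L) Q.* pow b (countEven L) Q.*_) (sum-cong (All.universal monomial (subsets L))) ⟩
  pow a (countOdd L) Q.* pow b (countEven L) Q.* Qplus m X Y ∎
  where
  a b X Y : ℚ
  a = 1ℚ - x
  b = 1ℚ - y
  X = (x ÷ (1ℚ - x)) {{≢-nonZero hx}}
  Y = (y ÷ (1ℚ - y)) {{≢-nonZero hy}}
  L : List ℕ
  L = range (m ∸ 1)
  σs : List (List ℤ)
  σs = signedPermsPlus m
  C W : ℕ → ℚ
  C = parity a b
  W = parity X Y

  C*W≡parity : ∀ e → C e Q.* W e ≡ parity x y e
  C*W≡parity e with isEven e
  ... | true  = [1-x]*[x÷[1-x]]≡x y hy
  ... | false = [1-x]*[x÷[1-x]]≡x x hx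

  C*[1+W]≡1 : ∀ e → C e Q.* (1ℚ Q.+ W e) ≡ 1ℚ
  C*[1+W]≡1 e with isEven e
  ... | true  = [1-x]*[1+x÷[1-x]]≡1 y hy
  ... | false = [1-x]*[1+x÷[1-x]]≡1 x hx

  via-upperSum : ∀ {σ} → Distinct (descSet σ) → descSet σ ⊆ L →
                 pow x (des₁ σ) Q.* pow y (des₀ σ) ≡ ∏ C L Q.* upperSum W L (descSet σ)
  via-upperSum {σ} distinct D⊆L = begin
    pow x (des₁ σ) Q.* pow y (des₀ σ)
      ≡⟨ ∏-parity x y (descSet σ) ⟨
    ∏ (parity x y) (descSet σ)
      ≡⟨ ∏-upperSum C W (parity x y) C*W≡parity C*[1+W]≡1 (Distinct-range (m ∸ 1)) distinct D⊆L ⟨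
    ∏ C L Q.* upperSum W L (descSet σ) ∎

  monomial : ∀ S → natℚ (alphaPlus m S) Q.* ∏ W S
                   ≡ natℚ (alphaPlus m S) Q.* pow X (countOdd S) Q.* pow Y (countEven S)
  monomial S = trans (cong (natℚ (alphaPlus m S) Q.*_) (∏-parity X Y S))
                     (sym (QP.*-assoc (natℚ (alphaPlus m S)) (pow X (countOdd S)) (pow Y (countEven S))))

2*suc∸1 : ∀ k → 2 * suc k ∸ 1 ≡ suc (k + k)
2*suc∸1 k = trans (ℕP.+-suc k (k + 0)) (cong (λ j → suc (k + j)) (ℕP.+-identityʳ k))

lemma4p2 : (n : ℕ) → 1 ≤ n → (x y : ℚ) → (hx : 1ℚ - x ≢ 0ℚ) → (hy : 1ℚ - y ≢ 0ℚ) →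
    (Bplus (2 * n) x y
      ≡ pow (1ℚ - x) n Q.* pow (1ℚ - y) (n ∸ 1)
          Q.* Qplus (2 * n) ((x ÷ (1ℚ - x)) {{≢-nonZero hx}}) ((y ÷ (1ℚ - y)) {{≢-nonZero hy}}))
    × (Bplus (2 * n ∸ 1) x y
      ≡ pow (1ℚ - x) (n ∸ 1) Q.* pow (1ℚ - y) (n ∸ 1)
          Q.* Qplus (2 * n ∸ 1) ((x ÷ (1ℚ - x)) {{≢-nonZero hx}}) ((y ÷ (1ℚ - y)) {{≢-nonZero hy}}))
lemma4p2 (suc k) _ x y hx hy =
  with-counts (2 * suc k) (2*suc∸1 k) (range-counts-odd k) ,
  with-counts (2 * suc k ∸ 1) (cong (_∸ 1) (2*suc∸1 k)) (range-counts-even k)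
  where
  with-counts : ∀ m {l i j} → m ∸ 1 ≡ l → countOdd (range l) ≡ i × countEven (range l) ≡ j →
    Bplus m x y ≡ pow (1ℚ - x) i Q.* pow (1ℚ - y) j
                    Q.* Qplus m ((x ÷ (1ℚ - x)) {{≢-nonZero hx}}) ((y ÷ (1ℚ - y)) {{≢-nonZero hy}})
  with-counts m refl (refl , refl) = Bplus≡Qplus m x y hx hy
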